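{- Let $k\ge 3$ and let $p_1\ge p_2\ge\cdots\ge p_k\ge 1$ and $q_1\ge q_2\ge\cdots\ge q_k\ge 1$ be two different $k$-tuples of integers with $\sum_{i=1}^k p_i=\sum_{i=1}^k q_i$. Then the complete $k$-partite graphs $K_{p_1,\ldots,p_k}$ and $K_{q_1,\ldots,q_k}$ are not switching equivalent.
   Context: All graphs are finite and simple. For a partition $V(G)=U\cup W$ of the vertex set of a graph $G$, Seidel switching with respect to $U$ produces the graph on the same vertex set obtained by deleting all edges between $U$ and $W$ and adding an edge between $u\in U$ and $w\in W$ whenever $uw$ was not an edge of $G$ (edges inside $U$ and inside $W$ are unchanged). Two graphs are switching equivalent if one is obtained from the other by a Seidel switching. -}

module Defs where

open import Data.Bool using (Bool; true; false; not; _xor_)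
open import Data.Nat using (ℕ)
open import Data.Fin using (Fin; _≟_)
open import Data.Product using (Σ; _×_; _,_; proj₁)
open import Data.Empty using (⊥-elim)
open import Function.Bundles using (_⤖_; Bijection)
open import Relation.Binary.PropositionalEquality using (_≡_; refl; sym)
open import Relation.Nullary using (does; yes; no)

record Graph (V : Set) : Set where
  field
    adj       : V → V → Bool
    adj-sym   : ∀ u v → adj u v ≡ adj v u
    adj-irrefl : ∀ v → adj v v ≡ false
open Graph public

-- Adjacency after Seidel switching w.r.t. U (given by indicator U : V → Bool):
-- the adjacency of u,v is flipped exactly when u,v are on different sides
-- of the partition {U, V∖U}; unchanged inside U and inside V∖U.
switchAdj : {V : Set} → Graph V → (V → Bool) → V → V → Bool
switchAdj G U u v = adj G u v xor (U u xor U v)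

_≅_ : {V W : Set} → Graph V → Graph W → Set
_≅_ {V} {W} G H =
  Σ (V ⤖ W) λ f → ∀ u v → adj H (Bijection.to f u) (Bijection.to f v) ≡ adj G u v

SwitchingEquivalent : {V W : Set} → Graph V → Graph W → Set
SwitchingEquivalent {V} G H =
  Σ (V → Bool) λ U →
    Σ (Graph V) λ G' → (∀ u v → adj G' u v ≡ switchAdj G U u v) × (G' ≅ H)

-- Vertex set of K_{p_1,...,p_k}: pairs (part i, index within part i).
KVert : (k : ℕ) → (Fin k → ℕ) → Set
KVert k p = Σ (Fin k) λ i → Fin (p i)

completeMultipartite : (k : ℕ) (p : Fin k → ℕ) → Graph (KVert k p)
completeMultipartite k p = record
  { adj = λ u v → not (does (proj₁ u ≟ proj₁ v))
  ; adj-sym = symP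
  ; adj-irrefl = irr
  }
  where
  symP : ∀ u v → not (does (proj₁ u ≟ proj₁ v)) ≡ not (does (proj₁ v ≟ proj₁ u))
  symP (i , _) (j , _) with i ≟ j | j ≟ i
  ... | yes _ | yes _ = refl
  ... | no _ | no _ = refl
  ... | yes e | no n = ⊥-elim (n (sym e))
  ... | no n | yes e = ⊥-elim (n (sym e))
  irr : ∀ v → not (does (proj₁ v ≟ proj₁ v)) ≡ false
  irr (i , _) with i ≟ i
  ... | yes _ = refl
  ... | no n = ⊥-elim (n refl)

module Submission where

-- Call an adjacency relation *co-transitive* when non-adjacency is
-- transitive.  Complete multipartite graphs are co-transitive (non-adjacent
-- means same part), and co-transitivity is inherited along
-- adjacency-preserving maps.  Suppose a switching of
-- K_p with respect to U is isomorphic to K_q.  Then the switched graph is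
-- co-transitive, and with three nonempty parts available this forces U to
-- be constant: a vertex in a third part would be non-adjacent to exactly
-- one of two vertices on different sides.  So K_p ≅ K_q itself.  An
-- isomorphism of complete multipartite graphs maps parts into parts,
-- giving an injection σ of parts with p i ≤ q (σ i).  For non-increasing
-- p and q a pigeonhole argument upgrades this to p i ≤ q i for every i,
-- and equal total sizes then force p = q.

open import Defs
open import Data.Nat using (ℕ; _≥_; _≤_; _+_)
open import Data.Fin using (Fin; _<_)
open import Data.Vec.Functional using (foldr)
open import Relation.Binary.PropositionalEquality using (_≡_)
open import Relation.Nullary using (¬_)

open import Data.Nat using (zero; suc; z≤n; s≤s; _≤?_; _<?_) renaming (_<_ to _<ℕ_)
import Data.Nat.Properties as ℕ
open import Data.Fin using (toℕ; fromℕ<; inject≤; _≟_)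
import Data.Fin.Properties as Fin
open import Data.Bool using (Bool; true; false; not; _xor_)
import Data.Bool.Properties as Bool
open import Data.Product using (Σ; _×_; _,_; proj₁; proj₂)
open import Data.Product.Properties using (Σ-≡,≡→≡; ,-injectiveʳ-UIP)
open import Axiom.UniquenessOfIdentityProofs using (module Decidable⇒UIP)
open import Data.Empty using (⊥; ⊥-elim)
open import Function.Bundles using (Bijection)
open import Function.Definitions using (Injective)
open import Relation.Binary.PropositionalEquality
  using (_≢_; refl; sym; trans; cong; cong₂; subst; module ≡-Reasoning)
open import Relation.Nullary using (yes; no; contradiction)
open import Relation.Nullary.Decidable using (dec-true; dec-false)

xor-≡ : ∀ {x y : Bool} → x ≡ y → x xor y ≡ false
xor-≡ {x} refl = Bool.xor-same x

xor-≢ : ∀ {x y : Bool} → x ≢ y → x xor y ≡ true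
xor-≢ {false} {false} x≢y = contradiction refl x≢y
xor-≢ {false} {true}  _   = refl
xor-≢ {true}  {false} _   = refl
xor-≢ {true}  {true}  x≢y = contradiction refl x≢y

bool-pigeonhole : ∀ {x y z : Bool} → x ≢ z → y ≢ z → x ≡ y
bool-pigeonhole {x} {y} {z} x≢z y≢z =
  trans (Bool.¬-not x≢z) (sym (Bool.¬-not y≢z))

module _ {k : ℕ} {p : Fin k → ℕ} where

  private
    K : Graph (KVert k p)
    K = completeMultipartite k p

  samePart⇒nonadjacent : ∀ u v → proj₁ u ≡ proj₁ v → adj K u v ≡ false
  samePart⇒nonadjacent u v eq = cong not (dec-true (proj₁ u ≟ proj₁ v) eq)

  differentParts⇒adjacent : ∀ u v → proj₁ u ≢ proj₁ v → adj K u v ≡ true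
  differentParts⇒adjacent u v neq = cong not (dec-false (proj₁ u ≟ proj₁ v) neq)

  nonadjacent⇒samePart : ∀ u v → adj K u v ≡ false → proj₁ u ≡ proj₁ v
  nonadjacent⇒samePart u v nonadj with proj₁ u ≟ proj₁ v
  ... | yes eq = eq
  ... | no _ with () ← nonadj

CoTransitive : {V : Set} → (V → V → Bool) → Set
CoTransitive {V} a = ∀ (u v w : V) → a u v ≡ false → a v w ≡ false → a u w ≡ false

multipartite-coTransitive : ∀ k (p : Fin k → ℕ) → CoTransitive (adj (completeMultipartite k p))
multipartite-coTransitive k p u v w uv wv =
  samePart⇒nonadjacent u w
    (trans (nonadjacent⇒samePart u v uv) (nonadjacent⇒samePart v w wv))

coTransitive-pullback : {V W : Set} (a : V → V → Bool) (b : W → W → Bool) (f : V → W)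
  → (∀ u v → a u v ≡ b (f u) (f v)) → CoTransitive b → CoTransitive a
coTransitive-pullback a b f a≡b b-co u v w uv vw =
  trans (a≡b u w) (b-co (f u) (f v) (f w) (trans (sym (a≡b u v)) uv) (trans (sym (a≡b v w)) vw))

switch-trivial : {V : Set} (G : Graph V) (U : V → Bool)
  → (∀ u v → U u ≡ U v) → ∀ u v → switchAdj G U u v ≡ adj G u v
switch-trivial G U U-const u v = begin
  adj G u v xor (U u xor U v) ≡⟨ cong (adj G u v xor_) (xor-≡ (U-const u v)) ⟩
  adj G u v xor false         ≡⟨ Bool.xor-identityʳ (adj G u v) ⟩
  adj G u v                   ∎
  where open ≡-Reasoning

avoidTwo : ∀ {k} (i j : Fin (3 + k)) → Σ (Fin (3 + k)) λ l → l ≢ i × l ≢ j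
avoidTwo Fin.zero Fin.zero = Fin.suc Fin.zero , (λ ()) , (λ ())
avoidTwo Fin.zero (Fin.suc Fin.zero) = Fin.suc (Fin.suc Fin.zero) , (λ ()) , (λ ())
avoidTwo Fin.zero (Fin.suc (Fin.suc j)) = Fin.suc Fin.zero , (λ ()) , (λ ())
avoidTwo (Fin.suc Fin.zero) Fin.zero = Fin.suc (Fin.suc Fin.zero) , (λ ()) , (λ ())
avoidTwo (Fin.suc Fin.zero) (Fin.suc j) = Fin.zero , (λ ()) , (λ ())
avoidTwo (Fin.suc (Fin.suc i)) Fin.zero = Fin.suc Fin.zero , (λ ()) , (λ ())
avoidTwo (Fin.suc (Fin.suc i)) (Fin.suc j) = Fin.zero , (λ ()) , (λ ())

module CoTransitiveSwitching {k : ℕ} (p : Fin (3 + k) → ℕ) (p-pos : ∀ i → p i ≥ 1)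
  (U : KVert (3 + k) p → Bool)
  (switched-co : CoTransitive (switchAdj (completeMultipartite (3 + k) p) U)) where

  private
    S : KVert (3 + k) p → KVert (3 + k) p → Bool
    S = switchAdj (completeMultipartite (3 + k) p) U

    vertexIn : ∀ i → KVert (3 + k) p
    vertexIn i = i , fromℕ< (p-pos i)

    crossing-differentSides : ∀ u v → proj₁ u ≢ proj₁ v → U u ≢ U v → S u v ≡ false
    crossing-differentSides u v parts sides =
      cong₂ _xor_ (differentParts⇒adjacent u v parts) (xor-≢ sides)

    crossing-sameSide : ∀ u v → proj₁ u ≢ proj₁ v → U u ≡ U v → S u v ≡ true
    crossing-sameSide u v parts side =
      cong₂ _xor_ (differentParts⇒adjacent u v parts) (xor-≡ side)

    -- Three vertices in distinct parts cannot have v on w's side but u on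
    -- the other: u would be non-adjacent to both v and w, which are adjacent.
    oddOneOut : ∀ u v w → proj₁ u ≢ proj₁ v → proj₁ u ≢ proj₁ w → proj₁ v ≢ proj₁ w
      → U u ≢ U w → U v ≡ U w → ⊥
    oddOneOut u v w uv uw vw u≢w v≡w = Bool.not-¬ refl
      (trans (sym (crossing-sameSide v w vw v≡w))
        (switched-co v u w
          (crossing-differentSides v u (λ e → uv (sym e)) (λ e → u≢w (trans (sym e) v≡w)))
          (crossing-differentSides u w uw u≢w)))

    sameSide-acrossParts : ∀ u w → proj₁ u ≢ proj₁ w → U u ≡ U w
    sameSide-acrossParts u w uw with U u Bool.≟ U w
    ... | yes u≡w = u≡w
    ... | no u≢w with avoidTwo (proj₁ u) (proj₁ w)
    ... | l , lu , lw with U (vertexIn l) Bool.≟ U w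
    ...   | yes v≡w = ⊥-elim (oddOneOut u (vertexIn l) w
                        (λ e → lu (sym e)) uw lw u≢w v≡w)
    ...   | no v≢w = ⊥-elim (oddOneOut w (vertexIn l) u
                        (λ e → lw (sym e)) (λ e → uw (sym e)) lu
                        (λ e → u≢w (sym e)) (bool-pigeonhole v≢w u≢w))

  switchingSet-constant : ∀ u w → U u ≡ U w
  switchingSet-constant u w with avoidTwo (proj₁ u) (proj₁ w)
  ... | l , lu , lw =
    trans (sameSide-acrossParts u (vertexIn l) (λ e → lu (sym e)))
          (sameSide-acrossParts (vertexIn l) w lw)

module PartMap {k l : ℕ} {p : Fin k → ℕ} {q : Fin l → ℕ} (p-pos : ∀ i → p i ≥ 1)
  (f : KVert k p → KVert l q) (f-injective : Injective _≡_ _≡_ f)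
  (f-adj : ∀ u v → adj (completeMultipartite l q) (f u) (f v) ≡ adj (completeMultipartite k p) u v)
  where

  private
    part : KVert k p → Fin l
    part u = proj₁ (f u)

    samePart-preserved : ∀ u v → proj₁ u ≡ proj₁ v → part u ≡ part v
    samePart-preserved u v eq =
      nonadjacent⇒samePart (f u) (f v) (trans (f-adj u v) (samePart⇒nonadjacent u v eq))

    differentParts-preserved : ∀ u v → proj₁ u ≢ proj₁ v → part u ≢ part v
    differentParts-preserved u v neq eq = Bool.not-¬ refl
      (trans (sym (differentParts⇒adjacent u v neq))
        (trans (sym (f-adj u v)) (samePart⇒nonadjacent (f u) (f v) eq)))

    base : ∀ i → Fin (p i)
    base i = fromℕ< (p-pos i)

  σ : Fin k → Fin l
  σ i = part (i , base i)

  σ-injective : Injective _≡_ _≡_ σ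
  σ-injective {i} {j} σi≡σj with i ≟ j
  ... | yes i≡j = i≡j
  ... | no i≢j = ⊥-elim (differentParts-preserved (i , base i) (j , base j) i≢j σi≡σj)

  private
    restrict : ∀ i → Fin (p i) → Fin (q (σ i))
    restrict i x = subst (λ j → Fin (q j)) (samePart-preserved (i , x) (i , base i) refl) (proj₂ (f (i , x)))

    f-on-part : ∀ i x → f (i , x) ≡ (σ i , restrict i x)
    f-on-part i x = Σ-≡,≡→≡ (samePart-preserved (i , x) (i , base i) refl , refl)

    restrict-injective : ∀ i → Injective _≡_ _≡_ (restrict i)
    restrict-injective i {x} {y} eq =
      ,-injectiveʳ-UIP (Decidable⇒UIP.≡-irrelevant _≟_)
        (f-injective (trans (f-on-part i x) (trans (cong (σ i ,_) eq) (sym (f-on-part i y)))))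

  part-size-≤ : ∀ i → p i ≤ q (σ i)
  part-size-≤ i = Fin.injective⇒≤ (restrict-injective i)

NonIncreasing : ∀ {k} → (Fin k → ℕ) → Set
NonIncreasing {k} p = ∀ (i j : Fin k) → i < j → p j ≤ p i

nonIncreasing-≤ : ∀ {k} {p : Fin k → ℕ} → NonIncreasing p
  → ∀ i j → toℕ i ≤ toℕ j → p j ≤ p i
nonIncreasing-≤ p-dec i j i≤j with toℕ i <? toℕ j
... | yes i<j = p-dec i j i<j
... | no i≮j with Fin.toℕ-injective (ℕ.≤-antisym i≤j (ℕ.≮⇒≥ i≮j))
... | refl = ℕ.≤-refl

-- Were q i < p i, every j ≤ i would satisfy
-- q i < p i ≤ p j ≤ q (σ j), hence σ j < i: an injection of the i+1
-- indices j ≤ i into the i indices below i.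
module Domination {k : ℕ} {p q : Fin k → ℕ} (p-dec : NonIncreasing p) (q-dec : NonIncreasing q)
  (σ : Fin k → Fin k) (σ-injective : Injective _≡_ _≡_ σ) (p≤qσ : ∀ i → p i ≤ q (σ i)) where

  private
    module _ (i : Fin k) (qi<pi : q i <ℕ p i) where

      i<k : suc (toℕ i) ≤ k
      i<k = Fin.toℕ<n i

      upTo : Fin (suc (toℕ i)) → Fin k
      upTo j = inject≤ j i<k

      σ-below : ∀ j → toℕ (σ (upTo j)) <ℕ toℕ i
      σ-below j with toℕ (σ (upTo j)) <? toℕ i
      ... | yes below = below
      ... | no notBelow = contradiction qi<pi (ℕ.≤⇒≯ (begin
          p i              ≤⟨ nonIncreasing-≤ p-dec (upTo j) i upTo-j≤i ⟩
          p (upTo j)       ≤⟨ p≤qσ (upTo j) ⟩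
          q (σ (upTo j))   ≤⟨ nonIncreasing-≤ q-dec i (σ (upTo j)) (ℕ.≮⇒≥ notBelow) ⟩
          q i              ∎))
        where
        open ℕ.≤-Reasoning
        upTo-j≤i : toℕ (upTo j) ≤ toℕ i
        upTo-j≤i = subst (_≤ toℕ i) (sym (Fin.toℕ-inject≤ j i<k)) (ℕ.≤-pred (Fin.toℕ<n j))

      squeeze : Fin (suc (toℕ i)) → Fin (toℕ i)
      squeeze j = fromℕ< (σ-below j)

      squeeze-injective : Injective _≡_ _≡_ squeeze
      squeeze-injective {a} {b} eq = Fin.inject≤-injective i<k i<k a b (σ-injective (Fin.toℕ-injective (begin
          toℕ (σ (upTo a))   ≡⟨ sym (Fin.toℕ-fromℕ< (σ-below a)) ⟩
          toℕ (squeeze a)    ≡⟨ cong toℕ eq ⟩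
          toℕ (squeeze b)    ≡⟨ Fin.toℕ-fromℕ< (σ-below b) ⟩
          toℕ (σ (upTo b))   ∎)))
        where open ≡-Reasoning

      impossible : ⊥
      impossible = ℕ.1+n≰n (Fin.injective⇒≤ squeeze-injective)

  dominated : ∀ i → p i ≤ q i
  dominated i with p i ≤? q i
  ... | yes pi≤qi = pi≤qi
  ... | no pi≰qi = ⊥-elim (impossible i (ℕ.≰⇒> pi≰qi))

sum : ∀ {k} → (Fin k → ℕ) → ℕ
sum = foldr _+_ 0

sum-mono : ∀ k {p q : Fin k → ℕ} → (∀ i → p i ≤ q i) → sum p ≤ sum q
sum-mono zero    p≤q = ℕ.≤-refl
sum-mono (suc k) p≤q = ℕ.+-mono-≤ (p≤q Fin.zero) (sum-mono k (λ i → p≤q (Fin.suc i)))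

+-tight : ∀ {a b s t} → a ≤ b → s ≤ t → a + s ≡ b + t → a ≡ b
+-tight {a} {b} {s} {t} a≤b s≤t eq = ℕ.≤-antisym a≤b (ℕ.+-cancelʳ-≤ s b a (begin
  b + s   ≤⟨ ℕ.+-monoʳ-≤ b s≤t ⟩
  b + t   ≡⟨ sym eq ⟩
  a + s   ∎))
  where open ℕ.≤-Reasoning

dominated-sameSum⇒equal : ∀ k {p q : Fin k → ℕ} → (∀ i → p i ≤ q i) → sum p ≡ sum q
  → ∀ i → p i ≡ q i
dominated-sameSum⇒equal (suc k) p≤q sums Fin.zero =
  +-tight (p≤q Fin.zero) (sum-mono k (λ i → p≤q (Fin.suc i))) sums
dominated-sameSum⇒equal (suc k) {p} {q} p≤q sums (Fin.suc i) =
  dominated-sameSum⇒equal k (λ j → p≤q (Fin.suc j)) tails-sameSum i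
  where
  heads : p Fin.zero ≡ q Fin.zero
  heads = dominated-sameSum⇒equal (suc k) p≤q sums Fin.zero
  tails-sameSum : sum (λ j → p (Fin.suc j)) ≡ sum (λ j → q (Fin.suc j))
  tails-sameSum = ℕ.+-cancelˡ-≡ (p Fin.zero) _ _
    (trans sums (cong (_+ sum (λ j → q (Fin.suc j))) (sym heads)))

theorem3p4 : (k : ℕ) → k ≥ 3 → (p q : Fin k → ℕ)
    → (∀ (i j : Fin k) → i < j → p j ≤ p i) → (∀ i → p i ≥ 1)
    → (∀ (i j : Fin k) → i < j → q j ≤ q i) → (∀ i → q i ≥ 1)
    → ¬ (∀ i → p i ≡ q i)
    → foldr _+_ 0 p ≡ foldr _+_ 0 q
    → ¬ SwitchingEquivalent (completeMultipartite k p) (completeMultipartite k q)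
theorem3p4 (suc (suc (suc k))) (s≤s (s≤s (s≤s z≤n))) p q p-dec p-pos q-dec _ p≢q sameSize
  (U , G' , G'-switched , f , G'≅Kq) =
  p≢q (dominated-sameSum⇒equal (3 + k) dominated sameSize)
  where
  Kp : Graph (KVert (3 + k) p)
  Kp = completeMultipartite (3 + k) p
  Kq : Graph (KVert (3 + k) q)
  Kq = completeMultipartite (3 + k) q
  to : KVert (3 + k) p → KVert (3 + k) q
  to = Bijection.to f

  switched≡Kq : ∀ u v → switchAdj Kp U u v ≡ adj Kq (to u) (to v)
  switched≡Kq u v = trans (sym (G'-switched u v)) (sym (G'≅Kq u v))

  switched-co : CoTransitive (switchAdj Kp U)
  switched-co = coTransitive-pullback _ _ to switched≡Kq (multipartite-coTransitive (3 + k) q)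

  Kp≅Kq : ∀ u v → adj Kq (to u) (to v) ≡ adj Kp u v
  Kp≅Kq u v = trans (sym (switched≡Kq u v))
    (switch-trivial Kp U (CoTransitiveSwitching.switchingSet-constant p p-pos U switched-co) u v)

  open PartMap p-pos to (Bijection.injective f) Kp≅Kq using (σ; σ-injective; part-size-≤)
  open Domination p-dec q-dec σ σ-injective part-size-≤ using (dominated)
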